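{- Let $\alpha=3+2\sqrt{2}$, $\beta=3-2\sqrt{2}$, and for integers $n\ge 0$ define $T_n=\frac{\alpha^n-\beta^n}{4\sqrt{2}}$ and $L_n=\alpha^n+\beta^n$. Then for every integer $n\ge 1$, $$T_{2n}L_{n-1}=(1+T_{2n-1})L_n=T_{3n-1}+T_{n+1}.$$ -}

module Defs where

open import Data.Nat using (ℕ; zero; suc)
open import Data.Product using (_×_; _,_; proj₁; proj₂)
open import Data.Rational.Unnormalised
  using (ℚᵘ; 0ℚᵘ; 1ℚᵘ; _≃_) renaming (_+_ to _+q_; _*_ to _*q_; -_ to -q_; _/_ to _/q_)
open import Data.Integer using (+_)

-- The field ℚ(√2): a pair (a , b) denotes a + b√2, with rational coefficients.
ℚ√2 : Set
ℚ√2 = ℚᵘ × ℚᵘ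

infixl 6 _+√_ _-√_
infixl 7 _*√_
infix 4 _≈√_

_+√_ : ℚ√2 → ℚ√2 → ℚ√2
(a , b) +√ (c , d) = (a +q c , b +q d)

-√_ : ℚ√2 → ℚ√2
-√ (a , b) = (-q a , -q b)

_-√_ : ℚ√2 → ℚ√2 → ℚ√2
x -√ y = x +√ (-√ y)

-- (a + b√2)(c + d√2) = (ac + 2bd) + (ad + bc)√2
_*√_ : ℚ√2 → ℚ√2 → ℚ√2
(a , b) *√ (c , d) =
  (a *q c +q (+ 2 /q 1) *q (b *q d) , a *q d +q b *q c)

-- equality of a + b√2 and c + d√2 (coefficientwise, as √2 is irrational)
_≈√_ : ℚ√2 → ℚ√2 → Set
(a , b) ≈√ (c , d) = (a ≃ c) × (b ≃ d)

one√ : ℚ√2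
one√ = (1ℚᵘ , 0ℚᵘ)

_^√_ : ℚ√2 → ℕ → ℚ√2
x ^√ zero = one√
x ^√ suc n = x *√ (x ^√ n)

α : ℚ√2
α = (+ 3 /q 1 , + 2 /q 1)

β : ℚ√2
β = (+ 3 /q 1 , -q (+ 2 /q 1))

-- 1 / (4√2) = √2 / 8
inv4√2 : ℚ√2
inv4√2 = (0ℚᵘ , + 1 /q 8)

T : ℕ → ℚ√2
T n = ((α ^√ n) -√ (β ^√ n)) *√ inv4√2

L : ℕ → ℚ√2
L n = (α ^√ n) +√ (β ^√ n)

{-# OPTIONS --safe #-}
-- T and L are the Lucas sequences Uₖ = (αᵏ − βᵏ)/(α − β) and Vₖ = αᵏ + βᵏ of a pair with
-- αβ = 1, and both identities hold in any commutative ring containing such α, β and an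
-- inverse c of α − β. Expanding (αᵃ⁺ᵏ − βᵃ⁺ᵏ)(αᵏ + βᵏ) and cancelling αᵏβᵏ = 1 gives the
-- product formula Uₐ₊ₖVₖ = Uₐ₊₂ₖ + Uₐ; expanding (α − β)Vₖ₊₁ the same way gives
-- Vₖ₊₁ + Uₖ = Uₖ₊₂. The first identity is the product formula at (a, k) = (n + 1, n − 1),
-- the second the product formula at (a, k) = (n − 1, n) followed by the recurrence.
-- In ℚ(√2), α − β = 4√2 is inverted by 1/(4√2).
module Submission where

open import Level using (0ℓ)
open import Algebra.Bundles using (CommutativeRing; AbelianGroup)
open import Algebra.Core using (Op₁; Op₂)
open import Algebra.Structures using (IsAbelianGroup; IsCommutativeRing)
import Algebra.Construct.DirectProduct as DirectProduct
import Algebra.Consequences.Setoid as Consequences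
import Algebra.Definitions as Definitions
import Algebra.Properties.AbelianGroup as AbelianGroupProperties
import Algebra.Properties.CommutativeSemigroup as CommutativeSemigroupProperties
import Algebra.Properties.Ring as RingProperties
import Algebra.Properties.Semiring.Exp as Exp
import Algebra.Solver.Ring.NaturalCoefficients.Default as NaturalCoefficients
open import Data.Integer using (+_)
open import Data.List using ([]; _∷_)
open import Data.Nat as ℕ using (ℕ; zero; suc)
import Data.Nat.Properties as ℕ
import Data.Nat.Tactic.RingSolver as ℕ-Solver
open import Data.Product using (_×_; _,_)
open import Data.Product.Relation.Binary.Pointwise.NonDependent using (Pointwise)
open import Data.Rational.Unnormalised using (*≡*) renaming (_/_ to _/q_)
import Data.Rational.Unnormalised.Properties as ℚᵘ
open import Relation.Binary.PropositionalEquality using (_≡_; cong; cong₂)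
import Relation.Binary.Reasoning.Setoid as SetoidReasoning

module CommutativeRingProperties {r ℓ} (R : CommutativeRing r ℓ) where

  open CommutativeRing R
  open Exp semiring using (_^_; ^-homo-*)
  open CommutativeSemigroupProperties *-commutativeSemigroup using (interchange)
  open RingProperties ring using (-‿distribˡ-*)
  open AbelianGroupProperties +-abelianGroup using (⁻¹-anti-homo‿-)
  -- Over an abstract ring the reflective solver cannot compare coefficients such as 1# * 1# and 1#,
  -- so ring identities are solved with natural-number coefficients, where negation is unavailable.
  open NaturalCoefficients commutativeSemiring using (solve; _:=_; _:+_; _:*_)
  open SetoidReasoning setoid

  [x-y][p+q]≈[xp-yq]+[xq-yp] : ∀ x y p q → (x - y) * (p + q) ≈ (x * p - y * q) + (x * q - y * p)
  [x-y][p+q]≈[xp-yq]+[xq-yp] x y p q = begin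
    (x + - y) * (p + q)
      ≈⟨ expand x (- y) p q ⟩
    (x * p + - y * q) + (x * q + - y * p)
      ≈⟨ +-cong (+-congˡ (-‿distribˡ-* y q)) (+-congˡ (-‿distribˡ-* y p)) ⟨
    (x * p - y * q) + (x * q - y * p)
      ∎
    where
    expand : ∀ x n p q → (x + n) * (p + q) ≈ (x * p + n * q) + (x * q + n * p)
    expand = solve 4 (λ x n p q → (x :+ n) :* (p :+ q) := (x :* p :+ n :* q) :+ (x :* q :+ n :* p)) refl

  [y-x]z+[x-y]z≈0 : ∀ x y z → (y - x) * z + (x - y) * z ≈ 0#
  [y-x]z+[x-y]z≈0 x y z = begin
    (y - x) * z + (x - y) * z      ≈⟨ distribʳ z (y - x) (x - y) ⟨
    ((y - x) + (x - y)) * z        ≈⟨ *-congʳ (+-congʳ (⁻¹-anti-homo‿- x y)) ⟨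
    (- (x - y) + (x - y)) * z      ≈⟨ *-congʳ (-‿inverseˡ (x - y)) ⟩
    0# * z                         ≈⟨ zeroˡ z ⟩
    0#                             ∎

  module _ {x y : Carrier} (xy≈1 : x * y ≈ 1#) where

    x[yz]≈z : ∀ z → x * (y * z) ≈ z
    x[yz]≈z z = begin
      x * (y * z)    ≈⟨ *-assoc x y z ⟨
      x * y * z      ≈⟨ *-congʳ xy≈1 ⟩
      1# * z         ≈⟨ *-identityˡ z ⟩
      z              ∎

    x^k*y^k≈1 : ∀ k → x ^ k * y ^ k ≈ 1#
    x^k*y^k≈1 zero    = *-identityˡ 1#
    x^k*y^k≈1 (suc k) = begin
      (x * x ^ k) * (y * y ^ k)   ≈⟨ interchange x (x ^ k) y (y ^ k) ⟩
      (x * y) * (x ^ k * y ^ k)   ≈⟨ *-cong xy≈1 (x^k*y^k≈1 k) ⟩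
      1# * 1#                     ≈⟨ *-identityˡ 1# ⟩
      1#                          ∎

    x^[i+k]*y^k≈x^i : ∀ i k → x ^ (i ℕ.+ k) * y ^ k ≈ x ^ i
    x^[i+k]*y^k≈x^i i k = begin
      x ^ (i ℕ.+ k) * y ^ k       ≈⟨ *-congʳ (^-homo-* x i k) ⟩
      x ^ i * x ^ k * y ^ k       ≈⟨ *-assoc (x ^ i) (x ^ k) (y ^ k) ⟩
      x ^ i * (x ^ k * y ^ k)     ≈⟨ *-congˡ (x^k*y^k≈1 k) ⟩
      x ^ i * 1#                  ≈⟨ *-identityʳ (x ^ i) ⟩
      x ^ i                       ∎

module LucasSequences {r ℓ} (R : CommutativeRing r ℓ) (α β c : CommutativeRing.Carrier R) where

  open CommutativeRing R
  open Exp semiring using (_^_; ^-homo-*)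
  open CommutativeRingProperties R
  open CommutativeSemigroupProperties +-commutativeSemigroup using (x∙yz≈y∙xz)
  open CommutativeSemigroupProperties *-commutativeSemigroup using (xy∙z≈xz∙y)
  open SetoidReasoning setoid

  U V : ℕ → Carrier
  U k = (α ^ k - β ^ k) * c
  V k = α ^ k + β ^ k

  U-cong-powers : ∀ i {x y} → x ≈ α ^ i → y ≈ β ^ i → (x - y) * c ≈ U i
  U-cong-powers _ x≈α^i y≈β^i = *-congʳ (+-cong x≈α^i (-‿cong y≈β^i))

  module _ (αβ≈1 : α * β ≈ 1#) where

    βα≈1 : β * α ≈ 1#
    βα≈1 = trans (*-comm β α) αβ≈1

    U-*-V : ∀ a k → U (a ℕ.+ k) * V k ≈ U (a ℕ.+ k ℕ.+ k) + U a
    U-*-V a k = begin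
      (x - y) * c * (p + q)
        ≈⟨ xy∙z≈xz∙y (x - y) c (p + q) ⟩
      (x - y) * (p + q) * c
        ≈⟨ *-congʳ ([x-y][p+q]≈[xp-yq]+[xq-yp] x y p q) ⟩
      ((x * p - y * q) + (x * q - y * p)) * c
        ≈⟨ distribʳ c (x * p - y * q) (x * q - y * p) ⟩
      (x * p - y * q) * c + (x * q - y * p) * c
        ≈⟨ +-cong (U-cong-powers (a ℕ.+ k ℕ.+ k) (sym (^-homo-* α (a ℕ.+ k) k))
                                                (sym (^-homo-* β (a ℕ.+ k) k)))
                  (U-cong-powers a (x^[i+k]*y^k≈x^i αβ≈1 a k) (x^[i+k]*y^k≈x^i βα≈1 a k)) ⟩
      U (a ℕ.+ k ℕ.+ k) + U a
        ∎
      where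
      x = α ^ (a ℕ.+ k)
      y = β ^ (a ℕ.+ k)
      p = α ^ k
      q = β ^ k

    U[2n]*V[n-1]≈U[3n-1]+U[n+1] :
      ∀ m → U (2 ℕ.* suc m) * V m ≈ U (3 ℕ.* m ℕ.+ 2) + U (suc m ℕ.+ 1)
    U[2n]*V[n-1]≈U[3n-1]+U[n+1] m = begin
      U (2 ℕ.* suc m) * V m
        ≡⟨ cong (λ i → U i * V m) 2[1+m]≡2+m+m ⟩
      U (2 ℕ.+ m ℕ.+ m) * V m
        ≈⟨ U-*-V (2 ℕ.+ m) m ⟩
      U (2 ℕ.+ m ℕ.+ m ℕ.+ m) + U (2 ℕ.+ m)
        ≡⟨ cong₂ (λ i j → U i + U j) 2+m+m+m≡3m+2 2+m≡[1+m]+1 ⟩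
      U (3 ℕ.* m ℕ.+ 2) + U (suc m ℕ.+ 1)
        ∎
      where
      2[1+m]≡2+m+m : 2 ℕ.* suc m ≡ 2 ℕ.+ m ℕ.+ m
      2[1+m]≡2+m+m = ℕ-Solver.solve (m ∷ [])
      2+m+m+m≡3m+2 : 2 ℕ.+ m ℕ.+ m ℕ.+ m ≡ 3 ℕ.* m ℕ.+ 2
      2+m+m+m≡3m+2 = ℕ-Solver.solve (m ∷ [])
      2+m≡[1+m]+1 : 2 ℕ.+ m ≡ suc m ℕ.+ 1
      2+m≡[1+m]+1 = cong suc (ℕ.+-comm 1 m)

    module _ ([α-β]c≈1 : (α - β) * c ≈ 1#) where

      V[1+k]+U[k]≈U[2+k] : ∀ k → V (suc k) + U k ≈ U (2 ℕ.+ k)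
      V[1+k]+U[k]≈U[2+k] k = begin
        V (suc k) + U k
          ≈⟨ +-congʳ (*-identityˡ (V (suc k))) ⟨
        1# * V (suc k) + U k
          ≈⟨ +-congʳ (*-congʳ [α-β]c≈1) ⟨
        (α - β) * c * V (suc k) + U k
          ≈⟨ +-congʳ (xy∙z≈xz∙y (α - β) c (V (suc k))) ⟩
        (α - β) * (α * A + β * B) * c + U k
          ≈⟨ +-congʳ (*-congʳ ([x-y][p+q]≈[xp-yq]+[xq-yp] α β (α * A) (β * B))) ⟩
        ((α * (α * A) - β * (β * B)) + (α * (β * B) - β * (α * A))) * c + U k
          ≈⟨ +-congʳ (distribʳ c _ _) ⟩
        U (2 ℕ.+ k) + (α * (β * B) - β * (α * A)) * c + U k
          ≈⟨ +-congʳ (+-congˡ (*-congʳ (+-cong (x[yz]≈z αβ≈1 B) (-‿cong (x[yz]≈z βα≈1 A))))) ⟩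
        U (2 ℕ.+ k) + (B - A) * c + (A - B) * c
          ≈⟨ +-assoc (U (2 ℕ.+ k)) _ _ ⟩
        U (2 ℕ.+ k) + ((B - A) * c + (A - B) * c)
          ≈⟨ +-congˡ ([y-x]z+[x-y]z≈0 A B c) ⟩
        U (2 ℕ.+ k) + 0#
          ≈⟨ +-identityʳ (U (2 ℕ.+ k)) ⟩
        U (2 ℕ.+ k)
          ∎
        where
        A = α ^ k
        B = β ^ k

      [1+U[2n-1]]*V[n]≈U[3n-1]+U[n+1] :
        ∀ m → (1# + U (2 ℕ.* m ℕ.+ 1)) * V (suc m) ≈ U (3 ℕ.* m ℕ.+ 2) + U (suc m ℕ.+ 1)
      [1+U[2n-1]]*V[n]≈U[3n-1]+U[n+1] m = begin
        (1# + U (2 ℕ.* m ℕ.+ 1)) * V (suc m)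
          ≡⟨ cong (λ i → (1# + U i) * V (suc m)) 2m+1≡m+[1+m] ⟩
        (1# + U (m ℕ.+ suc m)) * V (suc m)
          ≈⟨ distribʳ (V (suc m)) 1# (U (m ℕ.+ suc m)) ⟩
        1# * V (suc m) + U (m ℕ.+ suc m) * V (suc m)
          ≈⟨ +-cong (*-identityˡ (V (suc m))) (U-*-V m (suc m)) ⟩
        V (suc m) + (U (m ℕ.+ suc m ℕ.+ suc m) + U m)
          ≈⟨ x∙yz≈y∙xz (V (suc m)) _ (U m) ⟩
        U (m ℕ.+ suc m ℕ.+ suc m) + (V (suc m) + U m)
          ≈⟨ +-congˡ (V[1+k]+U[k]≈U[2+k] m) ⟩
        U (m ℕ.+ suc m ℕ.+ suc m) + U (2 ℕ.+ m)
          ≡⟨ cong₂ (λ i j → U i + U j) m+[1+m]+[1+m]≡3m+2 2+m≡[1+m]+1 ⟩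
        U (3 ℕ.* m ℕ.+ 2) + U (suc m ℕ.+ 1)
          ∎
        where
        2m+1≡m+[1+m] : 2 ℕ.* m ℕ.+ 1 ≡ m ℕ.+ suc m
        2m+1≡m+[1+m] = ℕ-Solver.solve (m ∷ [])
        m+[1+m]+[1+m]≡3m+2 : m ℕ.+ suc m ℕ.+ suc m ≡ 3 ℕ.* m ℕ.+ 2
        m+[1+m]+[1+m]≡3m+2 = ℕ-Solver.solve (m ∷ [])
        2+m≡[1+m]+1 : 2 ℕ.+ m ≡ suc m ℕ.+ 1
        2+m≡[1+m]+1 = cong suc (ℕ.+-comm 1 m)

module QuadraticExtension {r ℓ} (R : CommutativeRing r ℓ) (d : CommutativeRing.Carrier R) where

  open CommutativeRing R
    using (Carrier; _≈_; _+_; _*_; -_; 0#; 1#; refl; trans; +-abelianGroup; +-cong; +-comm;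
           +-identityʳ; *-cong; *-congˡ; *-comm; *-identityˡ; zeroˡ; zeroʳ; commutativeSemiring)
  open NaturalCoefficients commutativeSemiring using (solve; _:=_; _:+_; _:*_)

  infix  4 _≈ₑ_
  infixl 6 _+ₑ_
  infixl 7 _*ₑ_

  _≈ₑ_ : Carrier × Carrier → Carrier × Carrier → Set ℓ
  _≈ₑ_ = Pointwise _≈_ _≈_

  _+ₑ_ : Op₂ (Carrier × Carrier)
  (a , b) +ₑ (a′ , b′) = (a + a′ , b + b′)

  -ₑ_ : Op₁ (Carrier × Carrier)
  -ₑ (a , b) = (- a , - b)

  _*ₑ_ : Op₂ (Carrier × Carrier)
  (a , b) *ₑ (a′ , b′) = (a * a′ + d * (b * b′) , a * b′ + b * a′)

  0ₑ 1ₑ : Carrier × Carrier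
  0ₑ = (0# , 0#)
  1ₑ = (1# , 0#)

  open Definitions _≈ₑ_

  +ₑ-isAbelianGroup : IsAbelianGroup _≈ₑ_ _+ₑ_ 0ₑ -ₑ_
  +ₑ-isAbelianGroup = AbelianGroup.isAbelianGroup
    (DirectProduct.abelianGroup +-abelianGroup +-abelianGroup)

  *ₑ-cong : Congruent₂ _*ₑ_
  *ₑ-cong (p , q) (p′ , q′) =
    +-cong (*-cong p p′) (*-congˡ (*-cong q q′)) , +-cong (*-cong p q′) (*-cong q p′)

  *ₑ-comm : Commutative _*ₑ_
  *ₑ-comm (a , b) (a′ , b′) =
    +-cong (*-comm a a′) (*-congˡ (*-comm b b′)) ,
    trans (+-comm (a * b′) (b * a′)) (+-cong (*-comm b a′) (*-comm a b′))

  *ₑ-assoc : Associative _*ₑ_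
  *ₑ-assoc (a , b) (a′ , b′) (a″ , b″) =
    first d a b a′ b′ a″ b″ , second d a b a′ b′ a″ b″
    where
    first : ∀ d a b a′ b′ a″ b″ →
      (a * a′ + d * (b * b′)) * a″ + d * ((a * b′ + b * a′) * b″)
        ≈ a * (a′ * a″ + d * (b′ * b″)) + d * (b * (a′ * b″ + b′ * a″))
    first = solve 7 (λ d a b a′ b′ a″ b″ →
      (a :* a′ :+ d :* (b :* b′)) :* a″ :+ d :* ((a :* b′ :+ b :* a′) :* b″)
        := a :* (a′ :* a″ :+ d :* (b′ :* b″)) :+ d :* (b :* (a′ :* b″ :+ b′ :* a″))) refl
    second : ∀ d a b a′ b′ a″ b″ →
      (a * a′ + d * (b * b′)) * b″ + (a * b′ + b * a′) * a″
        ≈ a * (a′ * b″ + b′ * a″) + b * (a′ * a″ + d * (b′ * b″))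
    second = solve 7 (λ d a b a′ b′ a″ b″ →
      (a :* a′ :+ d :* (b :* b′)) :* b″ :+ (a :* b′ :+ b :* a′) :* a″
        := a :* (a′ :* b″ :+ b′ :* a″) :+ b :* (a′ :* a″ :+ d :* (b′ :* b″))) refl

  *ₑ-identityˡ : LeftIdentity 1ₑ _*ₑ_
  *ₑ-identityˡ (a , b) =
    trans (+-cong (*-identityˡ a) (trans (*-congˡ (zeroˡ b)) (zeroʳ d))) (+-identityʳ a) ,
    trans (+-cong (*-identityˡ b) (zeroˡ a)) (+-identityʳ b)

  *ₑ-distribˡ-+ₑ : _*ₑ_ DistributesOverˡ _+ₑ_
  *ₑ-distribˡ-+ₑ (a , b) (a′ , b′) (a″ , b″) =
    first d a b a′ b′ a″ b″ , second a b a′ b′ a″ b″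
    where
    first : ∀ d a b a′ b′ a″ b″ →
      a * (a′ + a″) + d * (b * (b′ + b″)) ≈ (a * a′ + d * (b * b′)) + (a * a″ + d * (b * b″))
    first = solve 7 (λ d a b a′ b′ a″ b″ →
      a :* (a′ :+ a″) :+ d :* (b :* (b′ :+ b″))
        := (a :* a′ :+ d :* (b :* b′)) :+ (a :* a″ :+ d :* (b :* b″))) refl
    second : ∀ a b a′ b′ a″ b″ →
      a * (b′ + b″) + b * (a′ + a″) ≈ (a * b′ + b * a′) + (a * b″ + b * a″)
    second = solve 6 (λ a b a′ b′ a″ b″ →
      a :* (b′ :+ b″) :+ b :* (a′ :+ a″) := (a :* b′ :+ b :* a′) :+ (a :* b″ :+ b :* a″)) refl

  isCommutativeRing : IsCommutativeRing _≈ₑ_ _+ₑ_ _*ₑ_ -ₑ_ 0ₑ 1ₑ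
  isCommutativeRing = record
    { isRing = record
      { +-isAbelianGroup = +ₑ-isAbelianGroup
      ; *-cong = *ₑ-cong
      ; *-assoc = *ₑ-assoc
      ; *-identity = comm∧idˡ⇒id *ₑ-comm *ₑ-identityˡ
      ; distrib = comm∧distrˡ⇒distr (IsAbelianGroup.∙-cong +ₑ-isAbelianGroup) *ₑ-comm *ₑ-distribˡ-+ₑ
      }
    ; *-comm = *ₑ-comm
    }
    where open Consequences (IsAbelianGroup.setoid +ₑ-isAbelianGroup)

  commutativeRing : CommutativeRing r ℓ
  commutativeRing = record { isCommutativeRing = isCommutativeRing }

open import Defs
open import Data.Nat using (_*_; _+_)
open import Relation.Binary.PropositionalEquality using (refl)

ℚ√2-commutativeRing : CommutativeRing 0ℓ 0ℓ
ℚ√2-commutativeRing = QuadraticExtension.commutativeRing ℚᵘ.+-*-commutativeRing (+ 2 /q 1)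

open CommutativeRing ℚ√2-commutativeRing using (reflexive; trans; sym; +-cong; +-congˡ; *-cong)
open Exp (CommutativeRing.semiring ℚ√2-commutativeRing) using (_^_)
open LucasSequences ℚ√2-commutativeRing α β inv4√2

α*β≈1 : α *√ β ≈√ one√
α*β≈1 = *≡* refl , *≡* refl

[α-β]*inv4√2≈1 : (α -√ β) *√ inv4√2 ≈√ one√
[α-β]*inv4√2≈1 = *≡* refl , *≡* refl

^√≡^ : ∀ x k → x ^√ k ≡ x ^ k
^√≡^ x zero    = refl
^√≡^ x (suc k) = cong (x *√_) (^√≡^ x k)

T≈U : ∀ k → T k ≈√ U k
T≈U k = reflexive (cong₂ (λ a b → (a -√ b) *√ inv4√2) (^√≡^ α k) (^√≡^ β k))

L≈V : ∀ k → L k ≈√ V k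
L≈V k = reflexive (cong₂ _+√_ (^√≡^ α k) (^√≡^ β k))

mainTheorem5 : (m : ℕ) → let n = suc m in
    (T (2 * n) *√ L m ≈√ (one√ +√ T (2 * m + 1)) *√ L n)
    × ((one√ +√ T (2 * m + 1)) *√ L n ≈√ T (3 * m + 2) +√ T (n + 1))
mainTheorem5 m = trans T[2n]L[n-1]≈T[3n-1]+T[n+1] (sym [1+T[2n-1]]L[n]≈T[3n-1]+T[n+1]) ,
                 [1+T[2n-1]]L[n]≈T[3n-1]+T[n+1]
  where
  T[3n-1]+T[n+1]≈U[3n-1]+U[n+1] : T (3 * m + 2) +√ T (suc m + 1) ≈√ U (3 * m + 2) +√ U (suc m + 1)
  T[3n-1]+T[n+1]≈U[3n-1]+U[n+1] = +-cong (T≈U (3 * m + 2)) (T≈U (suc m + 1))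

  T[2n]L[n-1]≈T[3n-1]+T[n+1] : T (2 * suc m) *√ L m ≈√ T (3 * m + 2) +√ T (suc m + 1)
  T[2n]L[n-1]≈T[3n-1]+T[n+1] = trans (*-cong (T≈U (2 * suc m)) (L≈V m))
    (trans (U[2n]*V[n-1]≈U[3n-1]+U[n+1] α*β≈1 m) (sym T[3n-1]+T[n+1]≈U[3n-1]+U[n+1]))

  [1+T[2n-1]]L[n]≈T[3n-1]+T[n+1] : (one√ +√ T (2 * m + 1)) *√ L (suc m) ≈√ T (3 * m + 2) +√ T (suc m + 1)
  [1+T[2n-1]]L[n]≈T[3n-1]+T[n+1] = trans (*-cong (+-congˡ {one√} (T≈U (2 * m + 1))) (L≈V (suc m)))
    (trans ([1+U[2n-1]]*V[n]≈U[3n-1]+U[n+1] α*β≈1 [α-β]*inv4√2≈1 m) (sym T[3n-1]+T[n+1]≈U[3n-1]+U[n+1]))
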